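{- Let $G$ be a loopless multigraph on $n$ vertices, and let $a,b$ be vertices of $G$ joined by $m\ge 2$ parallel edges. Let $G'$ be the multigraph obtained from $G$ by deleting all $m$ edges between $a$ and $b$, adding $2m$ new vertices $i_{j,1},i_{j,2}$ ($j\in[m]$), and adding the edges $\{a,i_{j,1}\},\{i_{j,1},i_{j,2}\},\{i_{j,2},b\}$ for every $j\in[m]$. Then $\mu(G')=\mu(G)+2m$.
   Context: For a multigraph $G$ with vertex set $V$, the size of a cut $A\subseteq V$ is the number of edges (counted with multiplicity) with exactly one endpoint in $A$, and $\mu(G)$ denotes the maximum size of a cut. -}

module Defs where

open import Data.Bool using (Bool; true; false; _xor_; _∧_; _∨_)
open import Data.Nat using (ℕ; zero; suc; _+_; _*_; _⊔_)
open import Data.Fin using (Fin; _↑ˡ_; _↑ʳ_; combine; zero; suc)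
open import Data.Fin.Properties using (_≟_)
open import Data.Product using (_×_; _,_)
open import Data.List using (List; []; _∷_; _++_; map; filter; length; foldr; concatMap)
open import Data.List.Relation.Unary.All using (All)
open import Data.Vec using (Vec; []; _∷_; lookup)
open import Relation.Nullary using (¬_)
open import Relation.Nullary.Decidable using (⌊_⌋)
open import Relation.Binary.PropositionalEquality using (_≡_)

-- A multigraph on vertex set Fin n: a list of edges (each edge an unordered
-- pair, stored as an ordered pair); multiplicity = number of occurrences
-- (in either orientation).
Multigraph : ℕ → Set
Multigraph n = List (Fin n × Fin n)

Loopless : ∀ {n} → Multigraph n → Set
Loopless G = All (λ { (u , v) → ¬ (u ≡ v) }) G

Cut : ℕ → Set
Cut n = Vec Bool n

crosses : ∀ {n} → Cut n → Fin n × Fin n → Bool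
crosses A (u , v) = lookup A u xor lookup A v

cutSize : ∀ {n} → Multigraph n → Cut n → ℕ
cutSize G A = length (filter (λ e → crosses A e Data.Bool.≟ true) G)

allCuts : (n : ℕ) → List (Cut n)
allCuts zero = [] ∷ []
allCuts (suc n) = concatMap (λ A → (false ∷ A) ∷ (true ∷ A) ∷ []) (allCuts n)

μ : ∀ {n} → Multigraph n → ℕ
μ {n} G = foldr _⊔_ 0 (map (cutSize G) (allCuts n))

isAB : ∀ {n} → Fin n → Fin n → Fin n × Fin n → Bool
isAB a b (u , v) = (⌊ u ≟ a ⌋ ∧ ⌊ v ≟ b ⌋) ∨ (⌊ u ≟ b ⌋ ∧ ⌊ v ≟ a ⌋)

mult : ∀ {n} → Multigraph n → Fin n → Fin n → ℕ
mult G a b = length (filter (λ e → isAB a b e Data.Bool.≟ true) G)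

removeAB : ∀ {n} → Multigraph n → Fin n → Fin n → Multigraph n
removeAB G a b = filter (λ e → isAB a b e Data.Bool.≟ false) G

-- G' : vertices Fin (n + m * 2); old vertex v ↦ v ↑ˡ (m * 2);
-- new vertex i_{j,t} (j : Fin m, t : Fin 2; t = 0 ↦ i_{j,1}, t = 1 ↦ i_{j,2}) ↦ n ↑ʳ combine j t
subdivide : ∀ {n} → Multigraph n → Fin n → Fin n → (m : ℕ) → Multigraph (n + m * 2)
subdivide {n} G a b m =
  map (λ { (u , v) → (old u , old v) }) (removeAB G a b)
  ++ concatMap (λ j → (old a , new j zero) ∷ (new j zero , new j (suc zero)) ∷ (new j (suc zero) , old b) ∷ [])
               (Data.List.allFin m)
  where
    old : Fin n → Fin (n + m * 2)
    old v = v ↑ˡ (m * 2)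
    new : Fin m → Fin 2 → Fin (n + m * 2)
    new j t = n ↑ʳ combine j t

{-# OPTIONS --safe #-}
-- Colour the two inner vertices of a path a — i₁ — i₂ — b in the cut. The path
-- then crosses at most 2 edges when a and b are on the same side and at most 3
-- when they are separated, i.e. at most 2 more than a single edge ab would; the
-- bound is attained by putting i₁ opposite to a and i₂ with a. So the best
-- extension of any cut of G to the new vertices gains exactly 2m edges.
module Submission where

open import Defs
open import Data.Bool using (Bool; true; false; not; _xor_)
open import Data.Bool.Properties using (xor-comm)
open import Data.Fin using (Fin; _↑ˡ_; _↑ʳ_; combine; remQuot; zero; suc)
open import Data.Fin.Properties using (_≟_; remQuot-combine)
open import Data.List using (List; []; _∷_; _++_; map; filter; length; foldr; concatMap; allFin)
open import Data.List.Membership.Propositional using (_∈_; lose)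
open import Data.List.Membership.Propositional.Properties using (∈-map⁺; ∈-map⁻; ∈-concatMap⁺)
open import Data.List.Relation.Unary.All using (universal)
open import Data.List.Relation.Unary.All.Properties using () renaming (map⁺ to All-map⁺)
open import Data.List.Relation.Unary.Any using (here; there)
open import Data.List.Properties using (length-tabulate; foldr-preservesᵇ; foldr-preservesᵒ)
open import Data.Nat using (ℕ; suc; _+_; _*_; _⊔_; _≤_; _≥_; z≤n)
open import Data.Nat.Properties
  using (≤-refl; ≤-reflexive; ≤-trans; ≤-antisym; ≤ᵇ⇒≤; n≤0⇒n≡0; +-assoc; +-identityʳ; *-zeroʳ;
         +-mono-≤; +-monoˡ-≤; +-monoʳ-≤; ⊔-sel; ⊔-lub; m≤n⇒m≤n⊔o; m≤n⇒m≤o⊔n; module ≤-Reasoning)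
open import Data.Nat.Solver using (module +-*-Solver)
open import Data.Product using (_×_; _,_; ∃; proj₂; uncurry)
open import Data.Sum using (_⊎_; inj₁; inj₂)
open import Data.Vec as Vec using (Vec; []; _∷_; lookup; tabulate)
open import Data.Vec.Properties using (lookup-++ˡ; lookup-++ʳ; lookup∘tabulate)
open import Function using (id)
open import Relation.Nullary using (yes; no)
open import Relation.Binary.PropositionalEquality
  using (_≡_; refl; sym; trans; cong; cong₂; subst; module ≡-Reasoning)

toℕ : Bool → ℕ
toℕ false = 0
toℕ true  = 1

count : {X : Set} → (X → Bool) → List X → ℕ
count p []       = 0
count p (x ∷ xs) = toℕ (p x) + count p xs

length-filter≡count : {X : Set} (p : X → Bool) (xs : List X) →
                      length (filter (λ x → p x Data.Bool.≟ true) xs) ≡ count p xs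
length-filter≡count p []       = refl
length-filter≡count p (x ∷ xs) with p x
... | true  = cong suc (length-filter≡count p xs)
... | false = length-filter≡count p xs

count-++ : {X : Set} (p : X → Bool) (xs ys : List X) → count p (xs ++ ys) ≡ count p xs + count p ys
count-++ p []       ys = refl
count-++ p (x ∷ xs) ys = trans (cong (toℕ (p x) +_) (count-++ p xs ys)) (sym (+-assoc (toℕ (p x)) _ _))

count-map : {X Y : Set} (p : Y → Bool) (q : X → Bool) (f : X → Y) →
            (∀ x → p (f x) ≡ q x) → (xs : List X) → count p (map f xs) ≡ count q xs
count-map p q f pf≗q []       = refl
count-map p q f pf≗q (x ∷ xs) = cong₂ _+_ (cong toℕ (pf≗q x)) (count-map p q f pf≗q xs)

count-concatMap-≤ : {X Y : Set} (p : Y → Bool) (f : X → List Y) {k : ℕ} →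
                    (∀ x → count p (f x) ≤ k) → (xs : List X) → count p (concatMap f xs) ≤ length xs * k
count-concatMap-≤ p f fx≤k []       = z≤n
count-concatMap-≤ p f {k} fx≤k (x ∷ xs) = begin
  count p (f x ++ concatMap f xs)         ≡⟨ count-++ p (f x) (concatMap f xs) ⟩
  count p (f x) + count p (concatMap f xs) ≤⟨ +-mono-≤ (fx≤k x) (count-concatMap-≤ p f fx≤k xs) ⟩
  k + length xs * k                        ∎
  where open ≤-Reasoning

count-concatMap-≡ : {X Y : Set} (p : Y → Bool) (f : X → List Y) {k : ℕ} →
                    (∀ x → count p (f x) ≡ k) → (xs : List X) → count p (concatMap f xs) ≡ length xs * k
count-concatMap-≡ p f fx≡k []       = refl
count-concatMap-≡ p f {k} fx≡k (x ∷ xs) = begin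
  count p (f x ++ concatMap f xs)         ≡⟨ count-++ p (f x) (concatMap f xs) ⟩
  count p (f x) + count p (concatMap f xs) ≡⟨ cong₂ _+_ (fx≡k x) (count-concatMap-≡ p f fx≡k xs) ⟩
  k + length xs * k                        ∎
  where open ≡-Reasoning

count-split : {X : Set} (p q : X → Bool) {c : Bool} → (∀ x → q x ≡ true → p x ≡ c) → (xs : List X) →
              count p xs ≡ count p (filter (λ x → q x Data.Bool.≟ false) xs) + toℕ c * count q xs
count-split p q {c} q⇒p≡c [] = sym (*-zeroʳ (toℕ c))
count-split p q {c} q⇒p≡c (x ∷ xs) with q x in qx≡
... | false = trans (cong (toℕ (p x) +_) (count-split p q q⇒p≡c xs)) (sym (+-assoc (toℕ (p x)) _ _))
... | true  = begin
  toℕ (p x) + count p xs            ≡⟨ cong₂ _+_ (cong toℕ (q⇒p≡c x qx≡)) (count-split p q q⇒p≡c xs) ⟩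
  toℕ c + (rest + toℕ c * count q xs)
    ≡⟨ solve 3 (λ c r k → c :+ (r :+ c :* k) := r :+ c :* (con 1 :+ k)) refl (toℕ c) rest (count q xs) ⟩
  rest + toℕ c * suc (count q xs)     ∎
  where
  open ≡-Reasoning
  open +-*-Solver
  rest : ℕ
  rest = count p (filter (λ x → q x Data.Bool.≟ false) xs)

∈-allCuts : ∀ {n} (A : Cut n) → A ∈ allCuts n
∈-allCuts []          = here refl
∈-allCuts (false ∷ A) = ∈-concatMap⁺ _ (lose (∈-allCuts A) (here refl))
∈-allCuts (true ∷ A)  = ∈-concatMap⁺ _ (lose (∈-allCuts A) (there (here refl)))

foldr-⊔-sel : (ns : List ℕ) → foldr _⊔_ 0 ns ≡ 0 ⊎ foldr _⊔_ 0 ns ∈ ns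
foldr-⊔-sel []       = inj₁ refl
foldr-⊔-sel (n ∷ ns) with ⊔-sel n (foldr _⊔_ 0 ns) | foldr-⊔-sel ns
... | inj₁ ⊔≡n | _          = inj₂ (here ⊔≡n)
... | inj₂ ⊔≡r | inj₁ r≡0   = inj₁ (trans ⊔≡r r≡0)
... | inj₂ ⊔≡r | inj₂ r∈ns  = inj₂ (there (subst (_∈ ns) (sym ⊔≡r) r∈ns))

cutSize≤μ : ∀ {n} (G : Multigraph n) (A : Cut n) → cutSize G A ≤ μ G
cutSize≤μ G A = foldr-preservesᵒ ≤-⊔ 0 _ (inj₂ (lose (∈-map⁺ (cutSize G) (∈-allCuts A)) ≤-refl))
  where
  ≤-⊔ : ∀ x y → cutSize G A ≤ x ⊎ cutSize G A ≤ y → cutSize G A ≤ x ⊔ y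
  ≤-⊔ x y (inj₁ ≤x) = m≤n⇒m≤n⊔o y ≤x
  ≤-⊔ x y (inj₂ ≤y) = m≤n⇒m≤o⊔n x ≤y

μ-lub : ∀ {n} (G : Multigraph n) {k : ℕ} → (∀ A → cutSize G A ≤ k) → μ G ≤ k
μ-lub G {k} A≤k = foldr-preservesᵇ {P = _≤ k} {f = _⊔_} ⊔-lub z≤n (All-map⁺ (universal A≤k (allCuts _)))

μ-attained : ∀ {n} (G : Multigraph n) → ∃ λ A → cutSize G A ≡ μ G
μ-attained {n} G with foldr-⊔-sel (map (cutSize G) (allCuts n))
... | inj₂ μ∈ with A , _ , μ≡ ← ∈-map⁻ (cutSize G) μ∈ = A , sym μ≡
... | inj₁ μ≡0 = A , trans (n≤0⇒n≡0 (subst (cutSize G A ≤_) μ≡0 (cutSize≤μ G A))) (sym μ≡0)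
  where
  A : Cut n
  A = Vec.replicate n false

isAB⇒crosses : ∀ {n} (A : Cut n) (a b : Fin n) (e : Fin n × Fin n) →
               isAB a b e ≡ true → crosses A e ≡ crosses A (a , b)
isAB⇒crosses A a b (u , v) isAB≡ with u ≟ a | v ≟ b | u ≟ b | v ≟ a
... | yes refl | yes refl | _        | _        = refl
... | _        | _        | yes refl | yes refl = xor-comm (lookup A b) (lookup A a)
isAB⇒crosses A a b (u , v) () | yes _ | no _ | yes _ | no _
isAB⇒crosses A a b (u , v) () | yes _ | no _ | no _  | _
isAB⇒crosses A a b (u , v) () | no _  | _    | yes _ | no _
isAB⇒crosses A a b (u , v) () | no _  | _    | no _  | _

cutSize-split : ∀ {n} (G : Multigraph n) (A : Cut n) (a b : Fin n) →
                cutSize G A ≡ count (crosses A) (removeAB G a b) + toℕ (crosses A (a , b)) * mult G a b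
cutSize-split G A a b = begin
  cutSize G A                                 ≡⟨ length-filter≡count (crosses A) G ⟩
  count (crosses A) G                         ≡⟨ count-split (crosses A) (isAB a b) (isAB⇒crosses A a b) G ⟩
  rest + toℕ (crosses A (a , b)) * count (isAB a b) G
    ≡⟨ cong (λ k → rest + toℕ (crosses A (a , b)) * k) (length-filter≡count (isAB a b) G) ⟨
  rest + toℕ (crosses A (a , b)) * mult G a b ∎
  where
  open ≡-Reasoning
  rest : ℕ
  rest = count (crosses A) (removeAB G a b)

pathCrossings : Bool → Bool → Bool → Bool → ℕ
pathCrossings p q r s = count (uncurry _xor_) ((p , q) ∷ (q , r) ∷ (r , s) ∷ [])

pathCrossings-≤ : ∀ p q r s → pathCrossings p q r s ≤ 2 + toℕ (p xor s)
pathCrossings-≤ false false false false = ≤ᵇ⇒≤ _ _ _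
pathCrossings-≤ false false false true  = ≤ᵇ⇒≤ _ _ _
pathCrossings-≤ false false true  false = ≤ᵇ⇒≤ _ _ _
pathCrossings-≤ false false true  true  = ≤ᵇ⇒≤ _ _ _
pathCrossings-≤ false true  false false = ≤ᵇ⇒≤ _ _ _
pathCrossings-≤ false true  false true  = ≤ᵇ⇒≤ _ _ _
pathCrossings-≤ false true  true  false = ≤ᵇ⇒≤ _ _ _
pathCrossings-≤ false true  true  true  = ≤ᵇ⇒≤ _ _ _
pathCrossings-≤ true  false false false = ≤ᵇ⇒≤ _ _ _
pathCrossings-≤ true  false false true  = ≤ᵇ⇒≤ _ _ _
pathCrossings-≤ true  false true  false = ≤ᵇ⇒≤ _ _ _
pathCrossings-≤ true  false true  true  = ≤ᵇ⇒≤ _ _ _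
pathCrossings-≤ true  true  false false = ≤ᵇ⇒≤ _ _ _
pathCrossings-≤ true  true  false true  = ≤ᵇ⇒≤ _ _ _
pathCrossings-≤ true  true  true  false = ≤ᵇ⇒≤ _ _ _
pathCrossings-≤ true  true  true  true  = ≤ᵇ⇒≤ _ _ _

pathCrossings-alternating : ∀ p s → pathCrossings p (not p) p s ≡ 2 + toℕ (p xor s)
pathCrossings-alternating false s = cong (2 +_) (+-identityʳ (toℕ s))
pathCrossings-alternating true  s = cong (2 +_) (+-identityʳ (toℕ (not s)))

module Subdivision {n : ℕ} (G : Multigraph n) (a b : Fin n) (m : ℕ) where

  G′ : Multigraph (n + m * 2)
  G′ = subdivide G a b m

  old : Fin n → Fin (n + m * 2)
  old v = v ↑ˡ (m * 2)

  new : Fin m → Fin 2 → Fin (n + m * 2)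
  new j t = n ↑ʳ combine j t

  path : Fin m → Multigraph (n + m * 2)
  path j = (old a , new j zero) ∷ (new j zero , new j (suc zero)) ∷ (new j (suc zero) , old b) ∷ []

  oldEdge : Fin n × Fin n → Fin (n + m * 2) × Fin (n + m * 2)
  oldEdge (u , v) = old u , old v

  cutSize-subdivide : (A : Cut n) (B : Vec Bool (m * 2)) →
                      cutSize G′ (A Vec.++ B) ≡
                      count (crosses A) (removeAB G a b) + count (crosses (A Vec.++ B)) (concatMap path (allFin m))
  cutSize-subdivide A B = begin
    cutSize G′ (A′)
      ≡⟨ length-filter≡count (crosses A′) G′ ⟩
    count (crosses A′) (map oldEdge (removeAB G a b) ++ concatMap path (allFin m))
      ≡⟨ count-++ (crosses A′) (map oldEdge (removeAB G a b)) (concatMap path (allFin m)) ⟩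
    count (crosses A′) (map oldEdge (removeAB G a b)) + count (crosses A′) (concatMap path (allFin m))
      ≡⟨ cong (_+ count (crosses A′) (concatMap path (allFin m)))
              (count-map (crosses A′) (crosses A) oldEdge old-crosses (removeAB G a b)) ⟩
    count (crosses A) (removeAB G a b) + count (crosses A′) (concatMap path (allFin m)) ∎
    where
    open ≡-Reasoning
    A′ : Cut (n + m * 2)
    A′ = A Vec.++ B
    old-crosses : ∀ e → crosses A′ (oldEdge e) ≡ crosses A e
    old-crosses (u , v) = cong₂ _xor_ (lookup-++ˡ A B u) (lookup-++ˡ A B v)

  count-path : (A : Cut n) (B : Vec Bool (m * 2)) (j : Fin m) →
               count (crosses (A Vec.++ B)) (path j) ≡
               pathCrossings (lookup A a) (lookup B (combine j zero)) (lookup B (combine j (suc zero))) (lookup A b)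
  count-path A B j
    rewrite lookup-++ˡ A B a | lookup-++ˡ A B b
          | lookup-++ʳ A B (combine j zero) | lookup-++ʳ A B (combine j (suc zero)) = refl

  alternatingCut : Bool → Vec Bool (m * 2)
  alternatingCut x = tabulate (λ i → lookup (not x ∷ x ∷ []) (proj₂ (remQuot {m} 2 i)))

  lookup-alternatingCut : ∀ x (j : Fin m) (t : Fin 2) → lookup (alternatingCut x) (combine j t) ≡ lookup (not x ∷ x ∷ []) t
  lookup-alternatingCut x j t = trans (lookup∘tabulate _ (combine j t))
                                      (cong (λ (_ , t′) → lookup (not x ∷ x ∷ []) t′) (remQuot-combine j t))

  module _ (mult≡m : mult G a b ≡ m) (A : Cut n) where

    private
      rest : ℕ
      rest = count (crosses A) (removeAB G a b)

      separates : ℕ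
      separates = toℕ (crosses A (a , b))

    cutSize+2m : cutSize G A + 2 * m ≡ rest + length (allFin m) * (2 + separates)
    cutSize+2m = begin
      cutSize G A + 2 * m                   ≡⟨ cong (_+ 2 * m) (cutSize-split G A a b) ⟩
      rest + separates * mult G a b + 2 * m ≡⟨ cong (λ k → rest + separates * k + 2 * m) mult≡m ⟩
      rest + separates * m + 2 * m          ≡⟨ solve 3 (λ r s m → r :+ s :* m :+ con 2 :* m := r :+ m :* (con 2 :+ s))
                                                     refl rest separates m ⟩
      rest + m * (2 + separates)            ≡⟨ cong (λ k → rest + k * (2 + separates)) (length-tabulate {n = m} id) ⟨
      rest + length (allFin m) * (2 + separates) ∎
      where
      open ≡-Reasoning
      open +-*-Solver

    cutSize-subdivide-≤ : (B : Vec Bool (m * 2)) → cutSize G′ (A Vec.++ B) ≤ cutSize G A + 2 * m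
    cutSize-subdivide-≤ B = begin
      cutSize G′ (A Vec.++ B)                                ≡⟨ cutSize-subdivide A B ⟩
      rest + count (crosses (A Vec.++ B)) (concatMap path (allFin m))
        ≤⟨ +-monoʳ-≤ rest (count-concatMap-≤ (crosses (A Vec.++ B)) path path≤ (allFin m)) ⟩
      rest + length (allFin m) * (2 + separates)             ≡⟨ cutSize+2m ⟨
      cutSize G A + 2 * m                                    ∎
      where
      open ≤-Reasoning
      path≤ : ∀ j → count (crosses (A Vec.++ B)) (path j) ≤ 2 + separates
      path≤ j = ≤-trans (≤-reflexive (count-path A B j)) (pathCrossings-≤ (lookup A a) (lookup B (combine j zero))
                                                                          (lookup B (combine j (suc zero))) (lookup A b))

    cutSize-subdivide-alternating : cutSize G′ (A Vec.++ alternatingCut (lookup A a)) ≡ cutSize G A + 2 * m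
    cutSize-subdivide-alternating = begin
      cutSize G′ (A Vec.++ B)                                ≡⟨ cutSize-subdivide A B ⟩
      rest + count (crosses (A Vec.++ B)) (concatMap path (allFin m))
        ≡⟨ cong (rest +_) (count-concatMap-≡ (crosses (A Vec.++ B)) path path≡ (allFin m)) ⟩
      rest + length (allFin m) * (2 + separates)             ≡⟨ cutSize+2m ⟨
      cutSize G A + 2 * m                                    ∎
      where
      open ≡-Reasoning
      B : Vec Bool (m * 2)
      B = alternatingCut (lookup A a)
      path≡ : ∀ j → count (crosses (A Vec.++ B)) (path j) ≡ 2 + separates
      path≡ j = begin
        count (crosses (A Vec.++ B)) (path j) ≡⟨ count-path A B j ⟩
        pathCrossings (lookup A a) (lookup B (combine j zero)) (lookup B (combine j (suc zero))) (lookup A b)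
          ≡⟨ cong₂ (λ q r → pathCrossings (lookup A a) q r (lookup A b))
                   (lookup-alternatingCut (lookup A a) j zero) (lookup-alternatingCut (lookup A a) j (suc zero)) ⟩
        pathCrossings (lookup A a) (not (lookup A a)) (lookup A a) (lookup A b)
          ≡⟨ pathCrossings-alternating (lookup A a) (lookup A b) ⟩
        2 + separates ∎

lemma28 : (n : ℕ) (G : Multigraph n) → Loopless G →
          (a b : Fin n) (m : ℕ) → m ≥ 2 → mult G a b ≡ m →
          μ (subdivide G a b m) ≡ μ G + 2 * m
lemma28 n G _ a b m _ mult≡m = ≤-antisym (μ-lub G′ bounded) attained
  where
  open Subdivision G a b m

  bounded : ∀ A′ → cutSize G′ A′ ≤ μ G + 2 * m
  bounded A′ with A , B , refl ← Vec.splitAt n A′ =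
    ≤-trans (cutSize-subdivide-≤ mult≡m A B) (+-monoˡ-≤ (2 * m) (cutSize≤μ G A))

  attained : μ G + 2 * m ≤ μ G′
  attained with A , cutSize≡μ ← μ-attained G = begin
    μ G + 2 * m                                        ≡⟨ cong (_+ 2 * m) cutSize≡μ ⟨
    cutSize G A + 2 * m                                ≡⟨ cutSize-subdivide-alternating mult≡m A ⟨
    cutSize G′ (A Vec.++ alternatingCut (lookup A a))  ≤⟨ cutSize≤μ G′ (A Vec.++ alternatingCut (lookup A a)) ⟩
    μ G′                                               ∎
    where open ≤-Reasoning
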